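{- Let $X$ be a non-empty finite set and let $\mathcal{R}$ be a rooted (binary) phylogenetic network on $X$. If $\mathcal{R}$ is tree-child, then every cherry-picking sequence associated with a complete cherry-reduction sequence for $\mathcal{R}$ is tree-child.
   Context: A rooted (binary) phylogenetic network on $X$ is a directed acyclic graph with no loops and no parallel arcs such that: (i) there is a unique vertex $\rho$ (the root) with in-degree 0 and out-degree 2; (ii) every vertex of out-degree 0 has in-degree 1, and the set of out-degree-0 vertices (leaves) is $X$; (iii) every other vertex has either in-degree 1 and out-degree 2 (a tree vertex) or in-degree 2 and out-degree 1 (a reticulation). If $|X|=1$, the single isolated vertex labelled by the element of $X$ is also a rooted phylogenetic network, and it is its own root. For a leaf $a$, $p_a$ denotes its unique parent. The reticulation number $r(\mathcal{R})$ is the number of reticulations. A rooted phylogenetic network is tree-child if every non-leaf vertex has a child that is a tree vertex or a leaf (equivalently, no two reticulations are joined by an arc and no two reticulations share a parent). For distinct $a,b\in X$: $[a,b]$ is a cherry of $\mathcal{R}$ if $p_a=p_b$; $(a,b)$ is a reticulated cherry (with reticulation leaf $a$) if $p_a$ is a reticulation and $(p_b,p_a)$ is an arc. Reducing the cherry $[a,b]$ means deleting $a$ and suppressing the resulting degree-2 vertex if $p_a\neq\rho$, and deleting $a$ and $p_a$ if $p_a=\rho$. Reducing the reticulated cherry $(a,b)$ means deleting the arc $(p_b,p_a)$ and suppressing the two resulting degree-2 vertices. These operations are cherry reductions. A cherry-reduction sequence for $\mathcal{R}$ is a sequence $(\mathcal{R}=\mathcal{R}_0,\mathcal{R}_1,\ldots,\mathcal{R}_k)$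 where each $\mathcal{R}_i$ is obtained from $\mathcal{R}_{i-1}$ by a cherry reduction; it is complete if $\mathcal{R}_k$ is a single vertex. The cherry-picking sequence associated with it is $(r_1,\ldots,r_k)$, where $r_i=[x_i,y_i]$ if $\mathcal{R}_i$ is obtained by reducing the cherry $[x_i,y_i]$ and $r_i=(x_i,y_i)$ if it is obtained by reducing the reticulated cherry $(x_i,y_i)$. We say $r_i$ contains $x_i$ and $y_i$. For a cherry-picking sequence $\Sigma=(r_1,\ldots,r_k)$ and $i\in\{1,\ldots,k\}$, let $s(i)$ be the smallest $j\in\{i+1,\ldots,k\}$ such that $r_j$ contains $x_i$ (the first coordinate of $r_i$), with $s(i)=\infty$ if no such $j$ exists; if $s(i)\neq\infty$, $S(i)=r_{s(i)}$ is the successor pair of $r_i$. $\Sigma$ is tree-child if (P1) for every $i$ with $r_i=(x_i,y_i)$ and $s(i)=j\neq\infty$, $S(i)$ is of the form $[x_j,y_j]$ (a cherry pair); and (P2) for any two distinct $i,j$ with $r_i=(x_i,y_i)$, $r_j=(x_j,y_j)$, $s(i)\neq\infty$, $s(j)\neq\infty$, we have $s(i)\neq s(j)$. -}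

module Defs where

open import Level using (Level; 0ℓ) renaming (suc to lsuc)
open import Data.Nat using (ℕ; zero; suc; _<_)
open import Data.List using (List; []; _∷_)
open import Data.List.Membership.Propositional using (_∈_)
open import Data.Maybe using (Maybe; just; nothing)
open import Data.Product using (Σ; ∃; ∃-syntax; _×_; _,_)
open import Data.Sum using (_⊎_)
open import Data.Empty using (⊥)
open import Relation.Nullary using (¬_)
open import Relation.Binary.PropositionalEquality using (_≡_; _≢_)

-- A relation cannot contain parallel arcs, so "no parallel arcs" is built in.
-- Leaves are identified with their labels (X ⊆ ℕ is the set of leaves).

record Graph : Set₁ where
  field
    V : ℕ → Set
    E : ℕ → ℕ → Set
open Graph public

module _ (G : Graph) where

  InDeg0 : ℕ → Set
  InDeg0 v = ∀ u → ¬ E G u v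

  InDeg1 : ℕ → Set
  InDeg1 v = ∃[ u ] (E G u v × (∀ u' → E G u' v → u' ≡ u))

  InDeg2 : ℕ → Set
  InDeg2 v = ∃[ u₁ ] ∃[ u₂ ] (u₁ ≢ u₂ × E G u₁ v × E G u₂ v
                × (∀ u' → E G u' v → u' ≡ u₁ ⊎ u' ≡ u₂))

  OutDeg0 : ℕ → Set
  OutDeg0 v = ∀ w → ¬ E G v w

  OutDeg1 : ℕ → Set
  OutDeg1 v = ∃[ w ] (E G v w × (∀ w' → E G v w' → w' ≡ w))

  OutDeg2 : ℕ → Set
  OutDeg2 v = ∃[ w₁ ] ∃[ w₂ ] (w₁ ≢ w₂ × E G v w₁ × E G v w₂
                × (∀ w' → E G v w' → w' ≡ w₁ ⊎ w' ≡ w₂))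

  IsLeaf : ℕ → Set
  IsLeaf v = V G v × OutDeg0 v

  IsTreeVertex : ℕ → Set
  IsTreeVertex v = V G v × InDeg1 v × OutDeg2 v

  IsReticulation : ℕ → Set
  IsReticulation v = V G v × InDeg2 v × OutDeg1 v

  data Path : ℕ → ℕ → Set where
    arc  : ∀ {u w} → E G u w → Path u w
    _▸_  : ∀ {u v w} → E G u v → Path v w → Path u w

  Acyclic : Set
  Acyclic = ∀ v → ¬ Path v v

  FiniteV : Set
  FiniteV = ∃[ l ] (∀ v → V G v → v ∈ l)

  ArcsInV : Set
  ArcsInV = ∀ u w → E G u w → V G u × V G w

  -- the single isolated vertex (a network on a one-element X)
  IsSingleVertex : Set
  IsSingleVertex = ∃[ x ] ((∀ v → V G v → v ≡ x) × V G x × (∀ u w → ¬ E G u w))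

  -- binary rooted phylogenetic network with at least one arc
  IsBinaryNetwork : Set
  IsBinaryNetwork =
    FiniteV × ArcsInV × Acyclic ×
    ∃[ ρ ] ( V G ρ × InDeg0 ρ × OutDeg2 ρ
           × (∀ v → V G v → InDeg0 v → v ≡ ρ)
           × (∀ v → V G v → v ≢ ρ →
                (OutDeg0 v × InDeg1 v)
              ⊎ (InDeg1 v × OutDeg2 v)
              ⊎ (InDeg2 v × OutDeg1 v)) )

  -- rooted (binary) phylogenetic network on X = its set of leaves
  IsNetwork : Set
  IsNetwork = IsSingleVertex ⊎ IsBinaryNetwork

  TreeChild : Set
  TreeChild = ∀ v → V G v → ¬ OutDeg0 v →
                ∃[ c ] (E G v c × (IsTreeVertex c ⊎ IsLeaf c))

  CherryAt : ℕ → ℕ → ℕ → Set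
  CherryAt a b p = a ≢ b × IsLeaf a × IsLeaf b × E G p a × E G p b

  RetCherryAt : ℕ → ℕ → ℕ → ℕ → Set
  RetCherryAt a b pa pb =
    a ≢ b × IsLeaf a × IsLeaf b × E G pa a × E G pb b
    × IsReticulation pa × E G pb pa

data Pair : Set where
  cherry : ℕ → ℕ → Pair
  ret    : ℕ → ℕ → Pair

fst : Pair → ℕ
fst (cherry x _) = x
fst (ret x _)    = x

Contains : Pair → ℕ → Set
Contains (cherry x y) z = z ≡ x ⊎ z ≡ y
Contains (ret x y) z    = z ≡ x ⊎ z ≡ y

-- Cherry reductions (result specified up to extensional equality of the
-- vertex and arc relations; vertex names are kept)

-- Reducing [a,b] with parent p: delete a, and
--  * if p is not the root, suppress p (arc (g,p) and (p,b) become (g,b));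
--  * if p is the root, delete p.
-- Both cases are captured by the same formula (if p is the root there is no
-- arc into p, so the second disjunct is empty).
ReduceCherry : Graph → ℕ → ℕ → Graph → Set
ReduceCherry G a b G' = ∃[ p ]
  ( CherryAt G a b p
  × (∀ v → V G' v → V G v × v ≢ a × v ≢ p)
  × (∀ v → V G v → v ≢ a → v ≢ p → V G' v)
  × (∀ u w → E G' u w →
        (E G u w × u ≢ a × u ≢ p × w ≢ a × w ≢ p) ⊎ (E G u p × w ≡ b))
  × (∀ u w → E G u w → u ≢ a → u ≢ p → w ≢ a → w ≢ p → E G' u w)
  × (∀ u → E G u p → E G' u b) )

-- Reducing (a,b): delete arc (p_b,p_a), suppress p_b and p_a.
ReduceRet : Graph → ℕ → ℕ → Graph → Set
ReduceRet G a b G' = ∃[ pa ] ∃[ pb ]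
  ( RetCherryAt G a b pa pb
  × (∀ v → V G' v → V G v × v ≢ pa × v ≢ pb)
  × (∀ v → V G v → v ≢ pa → v ≢ pb → V G' v)
  × (∀ u w → E G' u w →
        (E G u w × u ≢ pa × u ≢ pb × w ≢ pa × w ≢ pb)
      ⊎ (E G u pb × w ≡ b)
      ⊎ (E G u pa × u ≢ pb × w ≡ a))
  × (∀ u w → E G u w → u ≢ pa → u ≢ pb → w ≢ pa → w ≢ pb → E G' u w)
  × (∀ u → E G u pb → E G' u b)
  × (∀ u → E G u pa → u ≢ pb → E G' u a) )

Reduce : Graph → Pair → Graph → Set
Reduce G (cherry a b) G' = ReduceCherry G a b G'
Reduce G (ret a b)    G' = ReduceRet G a b G'

data CompleteCRS : Graph → List Pair → Set₁ where
  done : ∀ {G} → IsSingleVertex G → CompleteCRS G []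
  step : ∀ {G G' r σ} → Reduce G r G' → CompleteCRS G' σ → CompleteCRS G (r ∷ σ)

-- Tree-child cherry-picking sequences (positions are 0-based)

_!!_ : List Pair → ℕ → Maybe Pair
[]      !! _     = nothing
(r ∷ _) !! zero  = just r
(_ ∷ σ) !! suc i = σ !! i

Succ : List Pair → ℕ → ℕ → Set
Succ σ i j = ∃[ rᵢ ] ∃[ rⱼ ]
  ( σ !! i ≡ just rᵢ × σ !! j ≡ just rⱼ × i < j × Contains rⱼ (fst rᵢ)
  × (∀ k rₖ → i < k → k < j → σ !! k ≡ just rₖ → ¬ Contains rₖ (fst rᵢ)) )

P1 : List Pair → Set
P1 σ = ∀ i j x y → σ !! i ≡ just (ret x y) → Succ σ i j →
         ∃[ x' ] ∃[ y' ] (σ !! j ≡ just (cherry x' y'))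

P2 : List Pair → Set
P2 σ = ∀ i j k xᵢ yᵢ xⱼ yⱼ → i ≢ j →
         σ !! i ≡ just (ret xᵢ yᵢ) → σ !! j ≡ just (ret xⱼ yⱼ) →
         Succ σ i k → Succ σ j k → ⊥

TreeChildSeq : List Pair → Set
TreeChildSeq σ = P1 σ × P2 σ

module Submission where

-- Cherry reductions preserve three local consequences of being tree-child: leaves and
-- vertices with two children have in-degree at most 1, and every parent u of a
-- reticulation v is a tree parent of v (u has in-degree at most 1 and at most one child
-- besides v, which is no reticulation). They also keep a leaf below its tree parent as
-- long as the leaf itself is not reduced. Reducing a reticulated cherry (x , y) leaves x
-- below the other parent q of the reticulation p_x, a tree parent. So the next pair
-- containing x is no reticulated cherry: x would be its reticulation leaf, but q is no
-- reticulation, or its other leaf, but q has no reticulate child (P1). If a later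
-- reticulated cherry (x' , y') had the same successor, x and x' would be reduced together
-- as a cherry, so the new parent of x' would be q; but that new parent was a parent of
-- the reticulation p_x', and q has no reticulate child (P2).

open import Defs
open import Data.List using (List; _∷_)
open import Data.Nat using (ℕ; zero; suc; _<_; _≟_; s≤s; z≤n)
open import Data.Maybe using (just)
open import Data.Product using (∃-syntax; _×_; _,_; proj₁; proj₂)
open import Data.Sum using (_⊎_; inj₁; inj₂)
open import Data.Empty using (⊥-elim)
open import Relation.Nullary using (¬_; yes; no)
open import Relation.Binary.PropositionalEquality
  using (_≡_; _≢_; refl; sym; trans; subst; cong; ≢-sym)

other-of-pair-unique : ∀ {w₁ w₂ v c₁ c₂ : ℕ} → v ≡ w₁ ⊎ v ≡ w₂ →
  c₁ ≡ w₁ ⊎ c₁ ≡ w₂ → c₂ ≡ w₁ ⊎ c₂ ≡ w₂ → c₁ ≢ v → c₂ ≢ v → c₁ ≡ c₂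
other-of-pair-unique _           (inj₁ refl) (inj₁ refl) _    _    = refl
other-of-pair-unique _           (inj₂ refl) (inj₂ refl) _    _    = refl
other-of-pair-unique (inj₁ refl) (inj₁ refl) (inj₂ _)    c₁≢v _    = ⊥-elim (c₁≢v refl)
other-of-pair-unique (inj₂ refl) (inj₁ _)    (inj₂ refl) _    c₂≢v = ⊥-elim (c₂≢v refl)
other-of-pair-unique (inj₁ refl) (inj₂ _)    (inj₁ refl) _    c₂≢v = ⊥-elim (c₂≢v refl)
other-of-pair-unique (inj₂ refl) (inj₂ refl) (inj₁ _)    c₁≢v _    = ⊥-elim (c₁≢v refl)

InDeg≤1 : Graph → ℕ → Set
InDeg≤1 H v = ∀ {u₁ u₂} → E H u₁ v → E H u₂ v → u₁ ≡ u₂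

inDeg1⇒inDeg≤1 : ∀ {H v} → InDeg1 H v → InDeg≤1 H v
inDeg1⇒inDeg≤1 (_ , _ , parent-unique) e₁ e₂ =
  trans (parent-unique _ e₁) (sym (parent-unique _ e₂))

inDeg2⇒¬inDeg≤1 : ∀ {H v} → InDeg2 H v → ¬ InDeg≤1 H v
inDeg2⇒¬inDeg≤1 (_ , _ , u₁≢u₂ , e₁ , e₂ , _) inDeg≤1 = u₁≢u₂ (inDeg≤1 e₁ e₂)

inDeg2-other-parent : ∀ {H v w} → InDeg2 H v → E H w v → ∃[ u ] (E H u v × u ≢ w)
inDeg2-other-parent (u₁ , u₂ , u₁≢u₂ , e₁ , e₂ , parents) w→v with parents _ w→v
... | inj₁ w≡u₁ = u₂ , e₂ , λ u₂≡w → u₁≢u₂ (trans (sym w≡u₁) (sym u₂≡w))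
... | inj₂ w≡u₂ = u₁ , e₁ , λ u₁≡w → u₁≢u₂ (trans u₁≡w w≡u₂)

inDeg2-other-parent-unique : ∀ {H v w u₁ u₂} → InDeg2 H v → E H w v →
  E H u₁ v → E H u₂ v → u₁ ≢ w → u₂ ≢ w → u₁ ≡ u₂
inDeg2-other-parent-unique (_ , _ , _ , _ , _ , parents) w→v e₁ e₂ =
  other-of-pair-unique (parents _ w→v) (parents _ e₁) (parents _ e₂)

outDeg2-other-child-unique : ∀ {H u v c₁ c₂} → OutDeg2 H u → E H u v →
  E H u c₁ → E H u c₂ → c₁ ≢ v → c₂ ≢ v → c₁ ≡ c₂
outDeg2-other-child-unique (_ , _ , _ , _ , _ , children) u→v e₁ e₂ =
  other-of-pair-unique (children _ u→v) (children _ e₁) (children _ e₂)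

source≢leaf : ∀ H {u w x} → E H u w → OutDeg0 H x → u ≢ x
source≢leaf H {w = w} e leaf refl = leaf w e

record TreeParent (H : Graph) (u v : ℕ) : Set where
  field
    inDeg≤1         : InDeg≤1 H u
    sibling-inDeg≤1 : ∀ {c} → E H u c → c ≢ v → InDeg≤1 H c
    sibling-unique  : ∀ {c₁ c₂} → E H u c₁ → E H u c₂ → c₁ ≢ v → c₂ ≢ v → c₁ ≡ c₂

record Invariant (H : Graph) : Set where
  field
    leaf-inDeg≤1            : ∀ {v} → OutDeg0 H v → InDeg≤1 H v
    branching-inDeg≤1       : ∀ {v w₁ w₂} → E H v w₁ → E H v w₂ → w₁ ≢ w₂ → InDeg≤1 H v
    reticulation-treeParent : ∀ {u v} → E H u v → ¬ InDeg≤1 H v → TreeParent H u v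

record LeafWithTreeParent (H : Graph) (x q : ℕ) : Set where
  field
    parent        : E H q x
    parent-unique : ∀ {u} → E H u x → u ≡ q
    leaf          : OutDeg0 H x
    treeParent    : TreeParent H q x

leafWithTreeParent-inDeg≤1 : ∀ {H x q} → LeafWithTreeParent H x q → InDeg≤1 H x
leafWithTreeParent-inDeg≤1 ℓ e₁ e₂ = trans (parent-unique e₁) (sym (parent-unique e₂))
  where open LeafWithTreeParent ℓ

leafParent-children-inDeg≤1 : ∀ {H x q v} → LeafWithTreeParent H x q → E H q v → InDeg≤1 H v
leafParent-children-inDeg≤1 {x = x} {v = v} ℓ q→v with v ≟ x
... | yes refl = leafWithTreeParent-inDeg≤1 ℓ
... | no v≢x   = TreeParent.sibling-inDeg≤1 (LeafWithTreeParent.treeParent ℓ) q→v v≢x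

data VertexKind (G : Graph) (v : ℕ) : Set where
  tree-vertex         : InDeg≤1 G v → OutDeg2 G v → VertexKind G v
  leaf-vertex         : OutDeg0 G v → InDeg≤1 G v → VertexKind G v
  reticulation-vertex : InDeg2 G v → OutDeg1 G v → VertexKind G v

binaryNetwork-vertexKind : ∀ {G} → IsBinaryNetwork G → ∀ {v} → V G v → VertexKind G v
binaryNetwork-vertexKind {G} (_ , _ , _ , ρ , _ , ρ-inDeg0 , ρ-outDeg2 , _ , kind) {v} v∈V
  with v ≟ ρ
... | yes refl = tree-vertex (λ e₁ _ → ⊥-elim (ρ-inDeg0 _ e₁)) ρ-outDeg2
... | no v≢ρ with kind v v∈V v≢ρ
...   | inj₁ (outDeg0 , inDeg1)        = leaf-vertex outDeg0 (inDeg1⇒inDeg≤1 {G} inDeg1)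
...   | inj₂ (inj₁ (inDeg1 , outDeg2)) = tree-vertex (inDeg1⇒inDeg≤1 {G} inDeg1) outDeg2
...   | inj₂ (inj₂ (inDeg2 , outDeg1)) = reticulation-vertex inDeg2 outDeg1

module TreeChildNetwork {G : Graph} (arcs-in-V : ArcsInV G)
  (kind : ∀ {v} → V G v → VertexKind G v) (tree-child : TreeChild G) where

  sourceKind : ∀ {u w} → E G u w → VertexKind G u
  sourceKind e = kind (proj₁ (arcs-in-V _ _ e))

  leaf-inDeg≤1 : ∀ {v} → OutDeg0 G v → InDeg≤1 G v
  leaf-inDeg≤1 outDeg0 e₁ e₂ with kind (proj₂ (arcs-in-V _ _ e₁))
  ... | tree-vertex inDeg≤1 _             = inDeg≤1 e₁ e₂
  ... | leaf-vertex _ inDeg≤1             = inDeg≤1 e₁ e₂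
  ... | reticulation-vertex _ (w , e , _) = ⊥-elim (outDeg0 w e)

  branching-inDeg≤1 : ∀ {v w₁ w₂} → E G v w₁ → E G v w₂ → w₁ ≢ w₂ → InDeg≤1 G v
  branching-inDeg≤1 e₁ e₂ w₁≢w₂ with sourceKind e₁
  ... | tree-vertex inDeg≤1 _ = inDeg≤1
  ... | leaf-vertex outDeg0 _ = ⊥-elim (outDeg0 _ e₁)
  ... | reticulation-vertex _ (_ , _ , child-unique) =
    ⊥-elim (w₁≢w₂ (trans (child-unique _ e₁) (sym (child-unique _ e₂))))

  treeOrLeaf-inDeg≤1 : ∀ {c} → IsTreeVertex G c ⊎ IsLeaf G c → InDeg≤1 G c
  treeOrLeaf-inDeg≤1 (inj₁ (_ , inDeg1 , _)) = inDeg1⇒inDeg≤1 {G} inDeg1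
  treeOrLeaf-inDeg≤1 (inj₂ (_ , outDeg0))    = leaf-inDeg≤1 outDeg0

  reticulation-treeParent : ∀ {u v} → E G u v → ¬ InDeg≤1 G v → TreeParent G u v
  reticulation-treeParent {u} {v} u→v v-ret
    with sourceKind u→v | tree-child u (proj₁ (arcs-in-V _ _ u→v)) (λ outDeg0 → outDeg0 v u→v)
  ... | leaf-vertex outDeg0 _ | _ = ⊥-elim (outDeg0 v u→v)
  ... | reticulation-vertex _ (_ , _ , child-unique) | c , u→c , c-treeOrLeaf =
    ⊥-elim (v-ret (subst (InDeg≤1 G) (trans (child-unique c u→c) (sym (child-unique v u→v)))
                         (treeOrLeaf-inDeg≤1 c-treeOrLeaf)))
  ... | tree-vertex inDeg≤1 outDeg2 | c , u→c , c-treeOrLeaf = record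
    { inDeg≤1         = inDeg≤1
    ; sibling-inDeg≤1 = sibling-inDeg≤1
    ; sibling-unique  = outDeg2-other-child-unique {G} outDeg2 u→v
    }
    where
    c≢v : c ≢ v
    c≢v c≡v = v-ret (subst (InDeg≤1 G) c≡v (treeOrLeaf-inDeg≤1 c-treeOrLeaf))
    sibling-inDeg≤1 : ∀ {c'} → E G u c' → c' ≢ v → InDeg≤1 G c'
    sibling-inDeg≤1 u→c' c'≢v =
      subst (InDeg≤1 G) (outDeg2-other-child-unique {G} outDeg2 u→v u→c u→c' c≢v c'≢v)
            (treeOrLeaf-inDeg≤1 c-treeOrLeaf)

  invariant : Invariant G
  invariant = record
    { leaf-inDeg≤1            = leaf-inDeg≤1
    ; branching-inDeg≤1       = branching-inDeg≤1
    ; reticulation-treeParent = reticulation-treeParent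
    }

network-invariant : ∀ {G} → IsNetwork G → TreeChild G → Invariant G
network-invariant (inj₁ (_ , _ , _ , no-arc)) _ = record
  { leaf-inDeg≤1            = λ _ e₁ _ → ⊥-elim (no-arc _ _ e₁)
  ; branching-inDeg≤1       = λ e₁ _ _ → ⊥-elim (no-arc _ _ e₁)
  ; reticulation-treeParent = λ e _ → ⊥-elim (no-arc _ _ e)
  }
network-invariant (inj₂ binary) tree-child =
  TreeChildNetwork.invariant (proj₁ (proj₂ binary)) (binaryNetwork-vertexKind binary) tree-child

-- Every arc u → w of a reduced graph H' comes from the arc u → origin e of H, where
-- origin e is w itself or the suppressed vertex through which w is now reached.
record ArcOrigin (H H' : Graph) : Set where
  field
    origin            : ∀ {u w} → E H' u w → ℕ
    origin-arc        : ∀ {u w} (e : E H' u w) → E H u (origin e)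
    origin-injective  : ∀ {u w₁ w₂} (e₁ : E H' u w₁) (e₂ : E H' u w₂) →
                        origin e₁ ≡ origin e₂ → w₁ ≡ w₂
    origin-inDeg≤1    : ∀ {u w} (e : E H' u w) → InDeg≤1 H (origin e) → InDeg≤1 H' w
    inDeg≤1-preserved : ∀ {w} → InDeg≤1 H w → InDeg≤1 H' w

module ArcOriginProperties {H H' : Graph} (arcOrigin : ArcOrigin H H') (inv : Invariant H) where

  open ArcOrigin arcOrigin
  open Invariant inv

  outDeg0-preserved : ∀ {x} → OutDeg0 H x → OutDeg0 H' x
  outDeg0-preserved outDeg0 _ e = outDeg0 (origin e) (origin-arc e)

  treeParent-along : ∀ {u v v₀} (e : E H' u v) → origin e ≡ v₀ →
                     TreeParent H u v₀ → TreeParent H' u v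
  treeParent-along {u} {v} e refl tp = record
    { inDeg≤1         = inDeg≤1-preserved inDeg≤1
    ; sibling-inDeg≤1 = λ e' c≢v →
        origin-inDeg≤1 e' (sibling-inDeg≤1 (origin-arc e') (avoid e' c≢v))
    ; sibling-unique  = λ e₁ e₂ c₁≢v c₂≢v → origin-injective e₁ e₂
        (sibling-unique (origin-arc e₁) (origin-arc e₂) (avoid e₁ c₁≢v) (avoid e₂ c₂≢v))
    }
    where
    open TreeParent tp
    avoid : ∀ {c} (e' : E H' u c) → c ≢ v → origin e' ≢ origin e
    avoid e' c≢v eq = c≢v (origin-injective e' e eq)

  reticulation-treeParent′ : ∀ {u v} → E H' u v → ¬ InDeg≤1 H' v → TreeParent H' u v
  reticulation-treeParent′ e v-ret = treeParent-along e refl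
    (reticulation-treeParent (origin-arc e) (λ inDeg≤1 → v-ret (origin-inDeg≤1 e inDeg≤1)))

  branching-inDeg≤1′ : ∀ {v w₁ w₂} → E H' v w₁ → E H' v w₂ → w₁ ≢ w₂ → InDeg≤1 H' v
  branching-inDeg≤1′ e₁ e₂ w₁≢w₂ = inDeg≤1-preserved
    (branching-inDeg≤1 (origin-arc e₁) (origin-arc e₂) (λ eq → w₁≢w₂ (origin-injective e₁ e₂ eq)))

  invariant′ : (∀ {v} → OutDeg0 H' v → InDeg≤1 H' v) → Invariant H'
  invariant′ leaf-inDeg≤1′ = record
    { leaf-inDeg≤1            = leaf-inDeg≤1′
    ; branching-inDeg≤1       = branching-inDeg≤1′
    ; reticulation-treeParent = reticulation-treeParent′
    }

record ReductionStep (H H' : Graph) (r : Pair) : Set where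
  field
    invariant′              : Invariant H'
    leafWithTreeParent-kept : ∀ {x q} → ¬ Contains r x →
                              LeafWithTreeParent H x q → LeafWithTreeParent H' x q

ReattachedBelowTreeParent : Graph → Graph → ℕ → Set
ReattachedBelowTreeParent H H' x =
  ∃[ q ] ∃[ v ] (E H q v × ¬ InDeg≤1 H v × LeafWithTreeParent H' x q)

CherryArcOrigin : Graph → ℕ → ℕ → ℕ → ℕ → ℕ → Set
CherryArcOrigin H a b p u w = (E H u w × u ≢ a × u ≢ p × w ≢ a × w ≢ p) ⊎ (E H u p × w ≡ b)

module CherryReduction {H H' : Graph} {a b p : ℕ} (inv : Invariant H)
  (a≢b : a ≢ b) (a-leaf : OutDeg0 H a) (b-leaf : OutDeg0 H b) (p→a : E H p a) (p→b : E H p b)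
  (arc-origin : ∀ u w → E H' u w → CherryArcOrigin H a b p u w)
  (arc-kept : ∀ u w → E H u w → u ≢ a → u ≢ p → w ≢ a → w ≢ p → E H' u w)
  (arc-redirected : ∀ u → E H u p → E H' u b)
  where

  open Invariant inv

  a-parent : ∀ {u} → E H u a → u ≡ p
  a-parent e = leaf-inDeg≤1 a-leaf e p→a

  b-parent : ∀ {u} → E H u b → u ≡ p
  b-parent e = leaf-inDeg≤1 b-leaf e p→b

  p-inDeg≤1 : InDeg≤1 H p
  p-inDeg≤1 = branching-inDeg≤1 p→a p→b a≢b

  originOf : ∀ {u w} → CherryArcOrigin H a b p u w → ℕ
  originOf {w = w} (inj₁ _) = w
  originOf         (inj₂ _) = p

  originOf-arc : ∀ {u w} (o : CherryArcOrigin H a b p u w) → E H u (originOf o)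
  originOf-arc (inj₁ (e , _)) = e
  originOf-arc (inj₂ (e , _)) = e

  originOf-injective : ∀ {u w₁ w₂} (o₁ : CherryArcOrigin H a b p u w₁)
    (o₂ : CherryArcOrigin H a b p u w₂) → originOf o₁ ≡ originOf o₂ → w₁ ≡ w₂
  originOf-injective (inj₁ _) (inj₁ _) eq = eq
  originOf-injective (inj₁ (_ , _ , _ , _ , w₁≢p)) (inj₂ _) eq = ⊥-elim (w₁≢p eq)
  originOf-injective (inj₂ _) (inj₁ (_ , _ , _ , _ , w₂≢p)) eq = ⊥-elim (w₂≢p (sym eq))
  originOf-injective (inj₂ (_ , w₁≡b)) (inj₂ (_ , w₂≡b)) _ = trans w₁≡b (sym w₂≡b)

  originOf-kept : ∀ {u w} (o : CherryArcOrigin H a b p u w) → w ≢ b → originOf o ≡ w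
  originOf-kept (inj₁ _)          _   = refl
  originOf-kept (inj₂ (_ , w≡b)) w≢b = ⊥-elim (w≢b w≡b)

  kept-parent : ∀ {u w} → w ≢ b → E H' u w → E H u w
  kept-parent {u} w≢b e =
    subst (E H u) (originOf-kept (arc-origin _ _ e) w≢b) (originOf-arc (arc-origin _ _ e))

  b-parent′ : ∀ {u} → E H' u b → E H u p
  b-parent′ e with arc-origin _ _ e
  ... | inj₁ (e₀ , _ , u≢p , _) = ⊥-elim (u≢p (b-parent e₀))
  ... | inj₂ (e₀ , _)           = e₀

  inDeg≤1-preserved : ∀ {w} → InDeg≤1 H w → InDeg≤1 H' w
  inDeg≤1-preserved {w} inDeg≤1 with w ≟ b
  ... | yes refl = λ e₁ e₂ → p-inDeg≤1 (b-parent′ e₁) (b-parent′ e₂)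
  ... | no w≢b   = λ e₁ e₂ → inDeg≤1 (kept-parent w≢b e₁) (kept-parent w≢b e₂)

  originOf-inDeg≤1 : ∀ {u w} (o : CherryArcOrigin H a b p u w) →
                     InDeg≤1 H (originOf o) → InDeg≤1 H' w
  originOf-inDeg≤1 (inj₁ _)          = inDeg≤1-preserved
  originOf-inDeg≤1 (inj₂ (_ , refl)) _ = inDeg≤1-preserved (leaf-inDeg≤1 b-leaf)

  arcOrigin : ArcOrigin H H'
  arcOrigin = record
    { origin            = λ e → originOf (arc-origin _ _ e)
    ; origin-arc        = λ e → originOf-arc (arc-origin _ _ e)
    ; origin-injective  = λ e₁ e₂ → originOf-injective (arc-origin _ _ e₁) (arc-origin _ _ e₂)
    ; origin-inDeg≤1    = λ e → originOf-inDeg≤1 (arc-origin _ _ e)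
    ; inDeg≤1-preserved = inDeg≤1-preserved
    }

  open ArcOriginProperties arcOrigin inv

  outDeg0-reflect : ∀ {v} → v ≢ a → v ≢ p → OutDeg0 H' v → OutDeg0 H v
  outDeg0-reflect {v} v≢a v≢p outDeg0′ w e with w ≟ a | w ≟ p
  ... | yes refl | _        = v≢p (a-parent e)
  ... | no _     | yes refl = outDeg0′ b (arc-redirected v e)
  ... | no w≢a   | no w≢p   = outDeg0′ w (arc-kept v w e v≢a v≢p w≢a w≢p)

  leaf-inDeg≤1′ : ∀ {v} → OutDeg0 H' v → InDeg≤1 H' v
  leaf-inDeg≤1′ {v} outDeg0′ with v ≟ a | v ≟ p
  ... | yes refl | _        = inDeg≤1-preserved (leaf-inDeg≤1 a-leaf)
  ... | no _     | yes refl = inDeg≤1-preserved p-inDeg≤1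
  ... | no v≢a   | no v≢p   = inDeg≤1-preserved (leaf-inDeg≤1 (outDeg0-reflect v≢a v≢p outDeg0′))

  leafWithTreeParent-kept : ∀ {x q} → ¬ Contains (cherry a b) x →
                            LeafWithTreeParent H x q → LeafWithTreeParent H' x q
  leafWithTreeParent-kept {x} {q} x∉ab ℓ = record
    { parent        = q→x′
    ; parent-unique = λ e → parent-unique (kept-parent x≢b e)
    ; leaf          = outDeg0-preserved leaf
    ; treeParent    = treeParent-along q→x′ (originOf-kept (arc-origin _ _ q→x′) x≢b) treeParent
    }
    where
    open LeafWithTreeParent ℓ
    x≢a : x ≢ a
    x≢a x≡a = x∉ab (inj₁ x≡a)
    x≢b : x ≢ b
    x≢b x≡b = x∉ab (inj₂ x≡b)
    q≢p : q ≢ p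
    q≢p q≡p = a≢b (TreeParent.sibling-unique treeParent
      (subst (λ z → E H z a) (sym q≡p) p→a) (subst (λ z → E H z b) (sym q≡p) p→b)
      (≢-sym x≢a) (≢-sym x≢b))
    q→x′ : E H' q x
    q→x′ = arc-kept q x parent (source≢leaf H parent a-leaf) q≢p x≢a
                    (≢-sym (source≢leaf H p→a leaf))

  cherryStep : ReductionStep H H' (cherry a b)
  cherryStep = record
    { invariant′              = invariant′ leaf-inDeg≤1′
    ; leafWithTreeParent-kept = leafWithTreeParent-kept
    }

RetArcOrigin : Graph → ℕ → ℕ → ℕ → ℕ → ℕ → ℕ → Set
RetArcOrigin H a b pa pb u w =
    (E H u w × u ≢ pa × u ≢ pb × w ≢ pa × w ≢ pb)
  ⊎ (E H u pb × w ≡ b)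
  ⊎ (E H u pa × u ≢ pb × w ≡ a)

module RetReduction {H H' : Graph} {a b pa pb : ℕ} (inv : Invariant H)
  (a≢b : a ≢ b) (a-leaf : OutDeg0 H a) (b-leaf : OutDeg0 H b)
  (pa→a : E H pa a) (pb→b : E H pb b)
  (pa-inDeg2 : InDeg2 H pa) (pa-outDeg1 : OutDeg1 H pa) (pb→pa : E H pb pa)
  (arc-origin : ∀ u w → E H' u w → RetArcOrigin H a b pa pb u w)
  (arc-kept : ∀ u w → E H u w → u ≢ pa → u ≢ pb → w ≢ pa → w ≢ pb → E H' u w)
  (arc-redirected-b : ∀ u → E H u pb → E H' u b)
  (arc-redirected-a : ∀ u → E H u pa → u ≢ pb → E H' u a)
  where

  open Invariant inv

  pa-reticulate : ¬ InDeg≤1 H pa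
  pa-reticulate = inDeg2⇒¬inDeg≤1 {H} pa-inDeg2

  pa-child : ∀ {w} → E H pa w → w ≡ a
  pa-child {w} e = trans (child-unique w e) (sym (child-unique a pa→a))
    where
    child-unique : ∀ w' → E H pa w' → w' ≡ proj₁ pa-outDeg1
    child-unique = proj₂ (proj₂ pa-outDeg1)

  a-parent : ∀ {u} → E H u a → u ≡ pa
  a-parent e = leaf-inDeg≤1 a-leaf e pa→a

  b-parent : ∀ {u} → E H u b → u ≡ pb
  b-parent e = leaf-inDeg≤1 b-leaf e pb→b

  pa≢a : pa ≢ a
  pa≢a = source≢leaf H pa→a a-leaf

  pa≢b : pa ≢ b
  pa≢b = source≢leaf H pa→a b-leaf

  pb≢pa : pb ≢ pa
  pb≢pa pb≡pa = pa≢a (pa-child (subst (λ z → E H z pa) pb≡pa pb→pa))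

  pb-inDeg≤1 : InDeg≤1 H pb
  pb-inDeg≤1 = branching-inDeg≤1 pb→b pb→pa (≢-sym pa≢b)

  originOf : ∀ {u w} → RetArcOrigin H a b pa pb u w → ℕ
  originOf {w = w} (inj₁ _)        = w
  originOf         (inj₂ (inj₁ _)) = pb
  originOf         (inj₂ (inj₂ _)) = pa

  originOf-arc : ∀ {u w} (o : RetArcOrigin H a b pa pb u w) → E H u (originOf o)
  originOf-arc (inj₁ (e , _))        = e
  originOf-arc (inj₂ (inj₁ (e , _))) = e
  originOf-arc (inj₂ (inj₂ (e , _))) = e

  originOf-injective : ∀ {u w₁ w₂} (o₁ : RetArcOrigin H a b pa pb u w₁)
    (o₂ : RetArcOrigin H a b pa pb u w₂) → originOf o₁ ≡ originOf o₂ → w₁ ≡ w₂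
  originOf-injective (inj₁ _) (inj₁ _) eq = eq
  originOf-injective (inj₁ (_ , _ , _ , _ , w₁≢pb)) (inj₂ (inj₁ _)) eq = ⊥-elim (w₁≢pb eq)
  originOf-injective (inj₁ (_ , _ , _ , w₁≢pa , _)) (inj₂ (inj₂ _)) eq = ⊥-elim (w₁≢pa eq)
  originOf-injective (inj₂ (inj₁ _)) (inj₁ (_ , _ , _ , _ , w₂≢pb)) eq = ⊥-elim (w₂≢pb (sym eq))
  originOf-injective (inj₂ (inj₂ _)) (inj₁ (_ , _ , _ , w₂≢pa , _)) eq = ⊥-elim (w₂≢pa (sym eq))
  originOf-injective (inj₂ (inj₁ (_ , w₁≡b))) (inj₂ (inj₁ (_ , w₂≡b))) _ = trans w₁≡b (sym w₂≡b)
  originOf-injective (inj₂ (inj₂ (_ , _ , w₁≡a))) (inj₂ (inj₂ (_ , _ , w₂≡a))) _ =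
    trans w₁≡a (sym w₂≡a)
  originOf-injective (inj₂ (inj₁ _)) (inj₂ (inj₂ _)) eq = ⊥-elim (pb≢pa eq)
  originOf-injective (inj₂ (inj₂ _)) (inj₂ (inj₁ _)) eq = ⊥-elim (pb≢pa (sym eq))

  originOf-kept : ∀ {u w} (o : RetArcOrigin H a b pa pb u w) → w ≢ a → w ≢ b → originOf o ≡ w
  originOf-kept (inj₁ _)                    _   _   = refl
  originOf-kept (inj₂ (inj₁ (_ , w≡b)))     _   w≢b = ⊥-elim (w≢b w≡b)
  originOf-kept (inj₂ (inj₂ (_ , _ , w≡a))) w≢a _   = ⊥-elim (w≢a w≡a)

  originOf-a : ∀ {u} (o : RetArcOrigin H a b pa pb u a) → originOf o ≡ pa
  originOf-a (inj₁ (e₀ , u≢pa , _))  = ⊥-elim (u≢pa (a-parent e₀))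
  originOf-a (inj₂ (inj₁ (_ , a≡b))) = ⊥-elim (a≢b a≡b)
  originOf-a (inj₂ (inj₂ _))         = refl

  kept-parent : ∀ {u w} → w ≢ a → w ≢ b → E H' u w → E H u w
  kept-parent {u} w≢a w≢b e =
    subst (E H u) (originOf-kept (arc-origin _ _ e) w≢a w≢b) (originOf-arc (arc-origin _ _ e))

  b-parent′ : ∀ {u} → E H' u b → E H u pb
  b-parent′ e with arc-origin _ _ e
  ... | inj₁ (e₀ , _ , u≢pb , _)  = ⊥-elim (u≢pb (b-parent e₀))
  ... | inj₂ (inj₁ (e₀ , _))      = e₀
  ... | inj₂ (inj₂ (_ , _ , b≡a)) = ⊥-elim (a≢b (sym b≡a))

  a-parent′ : ∀ {u} → E H' u a → E H u pa × u ≢ pb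
  a-parent′ e with arc-origin _ _ e
  ... | inj₁ (e₀ , u≢pa , _)        = ⊥-elim (u≢pa (a-parent e₀))
  ... | inj₂ (inj₁ (_ , a≡b))       = ⊥-elim (a≢b a≡b)
  ... | inj₂ (inj₂ (e₀ , u≢pb , _)) = e₀ , u≢pb

  pa-other-parent-unique : ∀ {u₁ u₂} → E H u₁ pa → u₁ ≢ pb → E H u₂ pa → u₂ ≢ pb → u₁ ≡ u₂
  pa-other-parent-unique e₁ u₁≢pb e₂ u₂≢pb =
    inDeg2-other-parent-unique {H} pa-inDeg2 pb→pa e₁ e₂ u₁≢pb u₂≢pb

  inDeg≤1-preserved : ∀ {w} → InDeg≤1 H w → InDeg≤1 H' w
  inDeg≤1-preserved {w} inDeg≤1 with w ≟ a | w ≟ b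
  ... | yes refl | _ = λ e₁ e₂ → pa-other-parent-unique
    (proj₁ (a-parent′ e₁)) (proj₂ (a-parent′ e₁)) (proj₁ (a-parent′ e₂)) (proj₂ (a-parent′ e₂))
  ... | no _ | yes refl = λ e₁ e₂ → pb-inDeg≤1 (b-parent′ e₁) (b-parent′ e₂)
  ... | no w≢a | no w≢b = λ e₁ e₂ → inDeg≤1 (kept-parent w≢a w≢b e₁) (kept-parent w≢a w≢b e₂)

  originOf-inDeg≤1 : ∀ {u w} (o : RetArcOrigin H a b pa pb u w) →
                     InDeg≤1 H (originOf o) → InDeg≤1 H' w
  originOf-inDeg≤1 (inj₁ _)                     = inDeg≤1-preserved
  originOf-inDeg≤1 (inj₂ (inj₁ (_ , refl)))     _ = inDeg≤1-preserved (leaf-inDeg≤1 b-leaf)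
  originOf-inDeg≤1 (inj₂ (inj₂ (_ , _ , refl))) _ = inDeg≤1-preserved (leaf-inDeg≤1 a-leaf)

  arcOrigin : ArcOrigin H H'
  arcOrigin = record
    { origin            = λ e → originOf (arc-origin _ _ e)
    ; origin-arc        = λ e → originOf-arc (arc-origin _ _ e)
    ; origin-injective  = λ e₁ e₂ → originOf-injective (arc-origin _ _ e₁) (arc-origin _ _ e₂)
    ; origin-inDeg≤1    = λ e → originOf-inDeg≤1 (arc-origin _ _ e)
    ; inDeg≤1-preserved = inDeg≤1-preserved
    }

  open ArcOriginProperties arcOrigin inv

  pa-no-parent′ : ∀ {u} → ¬ E H' u pa
  pa-no-parent′ e with arc-origin _ _ e
  ... | inj₁ (_ , _ , _ , pa≢pa , _) = pa≢pa refl
  ... | inj₂ (inj₁ (_ , pa≡b))       = pa≢b pa≡b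
  ... | inj₂ (inj₂ (_ , _ , pa≡a))   = pa≢a pa≡a

  outDeg0-reflect : ∀ {v} → v ≢ pa → v ≢ pb → OutDeg0 H' v → OutDeg0 H v
  outDeg0-reflect {v} v≢pa v≢pb outDeg0′ w e with w ≟ pa | w ≟ pb
  ... | yes refl | _        = outDeg0′ a (arc-redirected-a v e v≢pb)
  ... | no _     | yes refl = outDeg0′ b (arc-redirected-b v e)
  ... | no w≢pa  | no w≢pb  = outDeg0′ w (arc-kept v w e v≢pa v≢pb w≢pa w≢pb)

  leaf-inDeg≤1′ : ∀ {v} → OutDeg0 H' v → InDeg≤1 H' v
  leaf-inDeg≤1′ {v} outDeg0′ with v ≟ pa | v ≟ pb
  ... | yes refl | _        = λ e₁ _ → ⊥-elim (pa-no-parent′ e₁)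
  ... | no _     | yes refl = inDeg≤1-preserved pb-inDeg≤1
  ... | no v≢pa  | no v≢pb  =
    inDeg≤1-preserved (leaf-inDeg≤1 (outDeg0-reflect v≢pa v≢pb outDeg0′))

  leafWithTreeParent-kept : ∀ {x q} → ¬ Contains (ret a b) x →
                            LeafWithTreeParent H x q → LeafWithTreeParent H' x q
  leafWithTreeParent-kept {x} {q} x∉ab ℓ = record
    { parent        = q→x′
    ; parent-unique = λ e → parent-unique (kept-parent x≢a x≢b e)
    ; leaf          = outDeg0-preserved leaf
    ; treeParent    =
        treeParent-along q→x′ (originOf-kept (arc-origin _ _ q→x′) x≢a x≢b) treeParent
    }
    where
    open LeafWithTreeParent ℓ
    x≢a : x ≢ a
    x≢a x≡a = x∉ab (inj₁ x≡a)
    x≢b : x ≢ b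
    x≢b x≡b = x∉ab (inj₂ x≡b)
    x≢pa : x ≢ pa
    x≢pa = ≢-sym (source≢leaf H pa→a leaf)
    q≢pa : q ≢ pa
    q≢pa q≡pa = x≢a (pa-child (subst (λ z → E H z x) q≡pa parent))
    q≢pb : q ≢ pb
    q≢pb q≡pb = pa≢b (sym (TreeParent.sibling-unique treeParent
      (subst (λ z → E H z b) (sym q≡pb) pb→b) (subst (λ z → E H z pa) (sym q≡pb) pb→pa)
      (≢-sym x≢b) (≢-sym x≢pa)))
    q→x′ : E H' q x
    q→x′ = arc-kept q x parent q≢pa q≢pb x≢pa (≢-sym (source≢leaf H pb→b leaf))

  a-leafWithTreeParent′ : ∀ {q} → E H q pa → q ≢ pb → LeafWithTreeParent H' a q
  a-leafWithTreeParent′ {q} q→pa q≢pb = record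
    { parent        = q→a′
    ; parent-unique = λ e → pa-other-parent-unique
        (proj₁ (a-parent′ e)) (proj₂ (a-parent′ e)) q→pa q≢pb
    ; leaf          = outDeg0-preserved a-leaf
    ; treeParent    = treeParent-along q→a′ (originOf-a (arc-origin _ _ q→a′))
                        (reticulation-treeParent q→pa pa-reticulate)
    }
    where
    q→a′ : E H' q a
    q→a′ = arc-redirected-a q q→pa q≢pb

  retStep : ReductionStep H H' (ret a b) × ReattachedBelowTreeParent H H' a
  retStep with inDeg2-other-parent {H} pa-inDeg2 pb→pa
  ... | q , q→pa , q≢pb =
    record { invariant′ = invariant′ leaf-inDeg≤1′
           ; leafWithTreeParent-kept = leafWithTreeParent-kept }
    , q , pa , q→pa , pa-reticulate , a-leafWithTreeParent′ q→pa q≢pb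

retReduction : ∀ {H H' a b} → Invariant H → ReduceRet H a b H' →
  ReductionStep H H' (ret a b) × ReattachedBelowTreeParent H H' a
retReduction inv
  (_ , _ , (a≢b , (_ , a-leaf) , (_ , b-leaf) , pa→a , pb→b , (_ , pa-inDeg2 , pa-outDeg1) , pb→pa)
   , _ , _ , arc-origin , arc-kept , arc-redirected-b , arc-redirected-a) =
  RetReduction.retStep inv a≢b a-leaf b-leaf pa→a pb→b pa-inDeg2 pa-outDeg1 pb→pa
    arc-origin arc-kept arc-redirected-b arc-redirected-a

reductionStep : ∀ {H H' r} → Invariant H → Reduce H r H' → ReductionStep H H' r
reductionStep {r = cherry a b} inv
  (_ , (a≢b , (_ , a-leaf) , (_ , b-leaf) , p→a , p→b)
   , _ , _ , arc-origin , arc-kept , arc-redirected) =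
  CherryReduction.cherryStep inv a≢b a-leaf b-leaf p→a p→b arc-origin arc-kept arc-redirected
reductionStep {r = ret a b} inv red = proj₁ (retReduction inv red)

reduceRet-reattachedBelowTreeParent : ∀ {H H' a b} → Invariant H → ReduceRet H a b H' →
  ReattachedBelowTreeParent H H' a
reduceRet-reattachedBelowTreeParent inv red = proj₂ (retReduction inv red)

leafWithTreeParent-notInRetCherry : ∀ {H x q a b pa pb} → LeafWithTreeParent H x q →
  RetCherryAt H a b pa pb → ¬ (x ≡ a ⊎ x ≡ b)
leafWithTreeParent-notInRetCherry {H} ℓ
  (_ , _ , _ , pa→a , _ , (_ , pa-inDeg2 , _) , _) (inj₁ refl) =
  inDeg2⇒¬inDeg≤1 {H} pa-inDeg2
    (subst (InDeg≤1 H) (sym (parent-unique pa→a)) (TreeParent.inDeg≤1 treeParent))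
  where open LeafWithTreeParent ℓ
leafWithTreeParent-notInRetCherry {H} ℓ
  (_ , _ , _ , _ , pb→b , (_ , pa-inDeg2 , _) , pb→pa) (inj₂ refl) =
  inDeg2⇒¬inDeg≤1 {H} pa-inDeg2
    (leafParent-children-inDeg≤1 ℓ (subst (λ z → E H z _) (parent-unique pb→b) pb→pa))
  where open LeafWithTreeParent ℓ

CherryPair : Pair → Set
CherryPair r = ∃[ x ] ∃[ y ] (r ≡ cherry x y)

leafWithTreeParent-reducedInCherry : ∀ {H H' r x q} → Reduce H r H' →
  LeafWithTreeParent H x q → Contains r x → CherryPair r
leafWithTreeParent-reducedInCherry {r = cherry a b} _ _ _ = a , b , refl
leafWithTreeParent-reducedInCherry {r = ret a b} (_ , _ , retCherry , _) ℓ x∈r =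
  ⊥-elim (leafWithTreeParent-notInRetCherry ℓ retCherry x∈r)

cherry-parent : ∀ {H a b p x} → CherryAt H a b p → Contains (cherry a b) x → E H p x
cherry-parent (_ , _ , _ , p→a , _)   (inj₁ refl) = p→a
cherry-parent (_ , _ , _ , _   , p→b) (inj₂ refl) = p→b

leafWithTreeParents-reducedTogether : ∀ {H H' r x x' q q'} → Reduce H r H' →
  LeafWithTreeParent H x q → LeafWithTreeParent H x' q' → Contains r x → Contains r x' → q ≡ q'
leafWithTreeParents-reducedTogether {r = cherry a b} (_ , cherryAt , _) ℓ ℓ' x∈r x'∈r =
  trans (sym (LeafWithTreeParent.parent-unique ℓ (cherry-parent cherryAt x∈r)))
        (LeafWithTreeParent.parent-unique ℓ' (cherry-parent cherryAt x'∈r))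
leafWithTreeParents-reducedTogether {r = ret a b} (_ , _ , retCherry , _) ℓ _ x∈r _ =
  ⊥-elim (leafWithTreeParent-notInRetCherry ℓ retCherry x∈r)

reduce-invariant : ∀ {H H' r} → Invariant H → Reduce H r H' → Invariant H'
reduce-invariant inv red = ReductionStep.invariant′ (reductionStep inv red)

AbsentBefore : List Pair → ℕ → ℕ → Set
AbsentBefore σ j x = ∀ k r → k < j → σ !! k ≡ just r → ¬ Contains r x

FirstOccurrence : List Pair → ℕ → ℕ → Pair → Set
FirstOccurrence σ j x r = σ !! j ≡ just r × Contains r x × AbsentBefore σ j x

firstOccurrence-tail : ∀ {r σ j x r'} → FirstOccurrence (r ∷ σ) (suc j) x r' →
  FirstOccurrence σ j x r'
firstOccurrence-tail (e , x∈r' , absent) = e , x∈r' , λ k r k<j → absent (suc k) r (s≤s k<j)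

reduce-beforeFirstOccurrence : ∀ {H H' r σ j x q r'} → Invariant H → Reduce H r H' →
  FirstOccurrence (r ∷ σ) (suc j) x r' → LeafWithTreeParent H x q → LeafWithTreeParent H' x q
reduce-beforeFirstOccurrence inv red (_ , _ , absent) =
  ReductionStep.leafWithTreeParent-kept (reductionStep inv red) (absent zero _ (s≤s z≤n) refl)

succ-tail : ∀ {r σ i j} → Succ (r ∷ σ) (suc i) (suc j) → Succ σ i j
succ-tail (rᵢ , rⱼ , eᵢ , eⱼ , s≤s i<j , x∈rⱼ , between) =
  rᵢ , rⱼ , eᵢ , eⱼ , i<j , x∈rⱼ , λ k rₖ i<k k<j → between (suc k) rₖ (s≤s i<k) (s≤s k<j)

succ-head : ∀ {r σ j} → Succ (r ∷ σ) zero (suc j) → ∃[ r' ] FirstOccurrence σ j (fst r) r'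
succ-head (_ , r' , refl , e , _ , x∈r' , between) =
  r' , e , x∈r' , λ k rₖ k<j → between (suc k) rₖ (s≤s z≤n) (s≤s k<j)

firstOccurrence-cherry : ∀ {H σ x q j r} → CompleteCRS H σ → Invariant H →
  LeafWithTreeParent H x q → FirstOccurrence σ j x r → CherryPair r
firstOccurrence-cherry (done _) _ _ (() , _)
firstOccurrence-cherry {j = zero} (step red _) _ ℓ (refl , x∈r , _) =
  leafWithTreeParent-reducedInCherry red ℓ x∈r
firstOccurrence-cherry {j = suc _} (step red crs) inv ℓ occ =
  firstOccurrence-cherry crs (reduce-invariant inv red) (reduce-beforeFirstOccurrence inv red occ ℓ)
    (firstOccurrence-tail occ)

firstOccurrence-sameParent : ∀ {H σ x x' q q' j r r'} → CompleteCRS H σ → Invariant H →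
  LeafWithTreeParent H x q → LeafWithTreeParent H x' q' →
  FirstOccurrence σ j x r → FirstOccurrence σ j x' r' → q ≡ q'
firstOccurrence-sameParent (done _) _ _ _ (() , _) _
firstOccurrence-sameParent {j = zero} (step red _) _ ℓ ℓ' (refl , x∈r , _) (refl , x'∈r , _) =
  leafWithTreeParents-reducedTogether red ℓ ℓ' x∈r x'∈r
firstOccurrence-sameParent {j = suc _} (step red crs) inv ℓ ℓ' occ occ' =
  firstOccurrence-sameParent crs (reduce-invariant inv red)
    (reduce-beforeFirstOccurrence inv red occ ℓ) (reduce-beforeFirstOccurrence inv red occ' ℓ')
    (firstOccurrence-tail occ) (firstOccurrence-tail occ')

firstOccurrence-notRetSuccessor : ∀ {H σ x q k r j x' y'} → CompleteCRS H σ → Invariant H →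
  LeafWithTreeParent H x q → FirstOccurrence σ k x r → σ !! j ≡ just (ret x' y') → ¬ Succ σ j k
firstOccurrence-notRetSuccessor (done _) _ _ (() , _) _ _
firstOccurrence-notRetSuccessor {k = zero} _ _ _ _ _ (_ , _ , _ , _ , () , _)
firstOccurrence-notRetSuccessor {H} {q = q} {k = suc _} {j = zero}
  (step red crs) inv ℓ occ refl s
  with reduceRet-reattachedBelowTreeParent inv red | succ-head s
... | q' , v , q'→v , v-ret , ℓ' | _ , occ' = v-ret (leafParent-children-inDeg≤1 ℓ q→v)
  where
  q≡q' : q ≡ q'
  q≡q' = firstOccurrence-sameParent crs (reduce-invariant {r = ret _ _} inv red)
    (reduce-beforeFirstOccurrence {r = ret _ _} inv red occ ℓ) ℓ' (firstOccurrence-tail occ) occ'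
  q→v : E H q v
  q→v = subst (λ z → E H z v) (sym q≡q') q'→v
firstOccurrence-notRetSuccessor {k = suc _} {j = suc _} (step red crs) inv ℓ occ e s =
  firstOccurrence-notRetSuccessor crs (reduce-invariant inv red)
    (reduce-beforeFirstOccurrence inv red occ ℓ) (firstOccurrence-tail occ) e (succ-tail s)

p1-cons : ∀ {H H' r σ} → Invariant H → Reduce H r H' → CompleteCRS H' σ → P1 σ → P1 (r ∷ σ)
p1-cons inv red crs _ zero (suc j) x y refl s
  with reduceRet-reattachedBelowTreeParent inv red | succ-head s
... | _ , _ , _ , _ , ℓ | _ , occ@(e , _)
  with firstOccurrence-cherry crs (reduce-invariant {r = ret x y} inv red) ℓ occ
...   | x' , y' , refl = x' , y' , e
p1-cons _ _ _ _ _ zero _ _ _ (_ , _ , _ , _ , () , _)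
p1-cons _ _ _ p1 (suc i) (suc j) x y e s = p1 i j x y e (succ-tail s)

headRet-successor-unshared : ∀ {H H' x y σ i k x' y'} → Invariant H → ReduceRet H x y H' →
  CompleteCRS H' σ → Succ (ret x y ∷ σ) zero (suc k) → σ !! i ≡ just (ret x' y') → ¬ Succ σ i k
headRet-successor-unshared {x = x} {y} inv red crs s e
  with reduceRet-reattachedBelowTreeParent inv red | succ-head s
... | _ , _ , _ , _ , ℓ | _ , occ =
  firstOccurrence-notRetSuccessor crs (reduce-invariant {r = ret x y} inv red) ℓ occ e

p2-cons : ∀ {H H' r σ} → Invariant H → Reduce H r H' → CompleteCRS H' σ → P2 σ → P2 (r ∷ σ)
p2-cons _ _ _ _ zero zero _ _ _ _ _ i≢j _ _ _ _ = i≢j refl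
p2-cons _ _ _ _ _ _ zero _ _ _ _ _ _ _ (_ , _ , _ , _ , () , _) _
p2-cons inv red crs _ zero (suc j) (suc k) _ _ _ _ _ refl eⱼ sᵢ sⱼ =
  headRet-successor-unshared inv red crs sᵢ eⱼ (succ-tail sⱼ)
p2-cons inv red crs _ (suc i) zero (suc k) _ _ _ _ _ eᵢ refl sᵢ sⱼ =
  headRet-successor-unshared inv red crs sⱼ eᵢ (succ-tail sᵢ)
p2-cons _ _ _ p2 (suc i) (suc j) (suc k) xᵢ yᵢ xⱼ yⱼ i≢j eᵢ eⱼ sᵢ sⱼ =
  p2 i j k xᵢ yᵢ xⱼ yⱼ (λ i≡j → i≢j (cong suc i≡j)) eᵢ eⱼ (succ-tail sᵢ) (succ-tail sⱼ)

completeCRS-treeChild : ∀ {H σ} → Invariant H → CompleteCRS H σ → TreeChildSeq σ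
completeCRS-treeChild _ (done _) = (λ _ _ _ _ ()) , (λ _ _ _ _ _ _ _ _ ())
completeCRS-treeChild inv (step red crs) with completeCRS-treeChild (reduce-invariant inv red) crs
... | p1 , p2 = p1-cons inv red crs p1 , p2-cons inv red crs p2

lemma3p2 : (G : Graph) → IsNetwork G → TreeChild G →
    (σ : List Pair) → CompleteCRS G σ → TreeChildSeq σ
lemma3p2 _ network tree-child _ = completeCRS-treeChild (network-invariant network tree-child)
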